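{- Let $F$ be the complete graph on the vertex set $\{0,1\}^2\setminus\{11\}=\{00,01,10\}$ (i.e. its edges are $\{00,01\},\{00,10\},\{01,10\}$). Then $$C_M(F)=\log_2 \alpha\approx 0.878,$$ where $\alpha^{ -1}$ is the unique positive root of the equation $x+x^2+x^3=1$.
   Context: Let $G$ be a simple graph whose vertex set is $\{0,1\}^2$, the set of ordered pairs of binary symbols (written as strings $ab$), or a subset of it, and whose edges are unordered pairs of distinct vertices. Two sequences $\mathbf{x}=(x_1,\dots,x_n),\mathbf{y}=(y_1,\dots,y_n)\in\{0,1\}^n$ are called distinguishable for $G$ if there exists $i\in\{1,\dots,n-1\}$ such that $\{x_ix_{i+1},\,y_iy_{i+1}\}$ is an edge of $G$. Let $M(G,n)$ be the largest cardinality of a set $C\subseteq\{0,1\}^n$ any two distinct elements of which are distinguishable for $G$. The Shannon–Markov capacity of $G$ is $C_M(G)=\limsup_{n\to\infty}\frac1n\log_2 M(G,n)$. -}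

module Defs where

open import Data.Bool using (Bool; true; false)
open import Data.Nat as ℕ using (ℕ; zero; suc)
open import Data.Fin using (Fin; toℕ)
open import Data.Vec using (Vec; lookup)
open import Data.List using (List; length)
open import Data.List.Relation.Unary.AllPairs using (AllPairs)
open import Data.Product using (_×_; _,_; Σ; ∃-syntax)
open import Data.Integer using (+_)
open import Data.Rational using (ℚ; _/_; _*_; 1ℚ)
open import Relation.Binary.PropositionalEquality using (_≡_; _≢_)

Pair : Set
Pair = Bool × Bool

Graph : Set₁
Graph = Pair → Pair → Set

F : Graph
F u v = (u ≢ v) × (u ≢ (true , true)) × (v ≢ (true , true))

-- x, y ∈ {0,1}^n are distinguishable for G if for some consecutive positions
-- i, i+1 (0-based here) the pairs x_i x_{i+1} and y_i y_{i+1} form an edge of G.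
Distinguishable : Graph → {n : ℕ} → Vec Bool n → Vec Bool n → Set
Distinguishable G {n} x y =
  ∃[ i ] ∃[ j ] ((toℕ j ≡ suc (toℕ i)) ×
                 G (lookup x i , lookup x j) (lookup y i , lookup y j))

-- A code for G of length n: a list of words, any two (distinct list entries)
-- distinguishable. (Distinguishable words are automatically distinct since
-- edges join distinct vertices, so length = cardinality.)
IsCode : Graph → (n : ℕ) → List (Vec Bool n) → Set
IsCode G n C = AllPairs (Distinguishable G) C

toℚ : ℕ → ℚ
toℚ k = (+ k) / 1

pow : ℚ → ℕ → ℚ
pow x zero    = 1ℚ
pow x (suc n) = x * pow x n

-- Two words are confusable for F exactly when, at every position, their pairs coincide or one
-- of them is 11.  Upper bound: every word x has a representative without 111 that agrees with x
-- on each pair other than 11; distinguishable words have distinct representatives, so a code is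
-- no larger than the set of 111-free words.  Lower bound: the words 0w, with w a concatenation of
-- the blocks 0, 10, 110, are pairwise distinguishable at the first block where they differ.  Both
-- families are counted by t(n+3) = t(n+2) + t(n+1) + t(n), so b(n) = t(n) xⁿ satisfies a linear
-- recurrence with coefficients x, x², x³ of sum s = x + x² + x³: it is at most a constant times
-- s^⌊n/3⌋ when s < 1 and at least a positive constant times it when s > 1, and Bernoulli's
-- inequality turns these geometric rates into explicit lengths.
module Submission where

open import Defs
open import Data.Nat using (ℕ; _≥_)
open import Data.List using (List; length)
open import Data.Vec using (Vec)
open import Data.Bool using (Bool)
open import Data.Product using (_×_; Σ; ∃-syntax)
open import Data.Rational using (ℚ; _+_; _*_; _<_; _≤_; 0ℚ; 1ℚ)

open import Algebra.Bundles using (CommutativeMonoid)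
open import Data.Bool using (true; false)
open import Data.Fin using (zero; suc)
open import Data.Integer as ℤ using (+_; -[1+_])
import Data.Integer.Properties as ℤ
open import Data.List using ([]; _∷_; _++_; map)
open import Data.List.Membership.Propositional using (_∈_)
open import Data.List.Membership.Propositional.Properties using (∈-map⁺; ∈-map⁻; ∈-++⁺ˡ; ∈-++⁺ʳ)
open import Data.List.Properties using (length-map; length-++; length-removeAt′)
open import Data.List.Relation.Binary.Subset.Propositional using (_⊆_)
open import Data.List.Relation.Unary.All as All using (All; []; _∷_)
import Data.List.Relation.Unary.All.Properties as All
open import Data.List.Relation.Unary.AllPairs as AllPairs using (AllPairs; []; _∷_)
import Data.List.Relation.Unary.AllPairs.Properties as AllPairs
open import Data.List.Relation.Unary.Any using (here; there; index; _─_)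
open import Data.List.Relation.Unary.Unique.Propositional using (Unique)
open import Data.Nat as ℕ using (zero; suc; z≤n; s≤s)
import Data.Nat.Coprimality as Coprimality
import Data.Nat.Properties as ℕ
open import Data.Product using (_,_)
open import Data.Rational using (mkℚ; _/_; _-_; -_; 1/_; _⊔_; _⊓_; *≤*; *<*; NonZero; nonNegative; positive)
open import Data.Rational.Properties
open import Data.Sum using (_⊎_; inj₁; inj₂; [_,_]; [_,_]′)
open import Data.Unit using (⊤; tt)
open import Data.Vec using ([]; _∷_)
open import Function using (_∘_)
open import Level using (0ℓ)
open import Relation.Binary.PropositionalEquality
  using (_≡_; _≢_; refl; sym; trans; cong; cong₂; subst; subst₂; ≢-sym; module ≡-Reasoning)
open import Relation.Nullary using (¬_; contradiction)
open import Relation.Nullary.Decidable using (dec⇒maybe)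
import Tactic.RingSolver.Core.AlmostCommutativeRing as ACR
open import Tactic.RingSolver using (solve-∀)

open import Algebra.Properties.CommutativeSemigroup
  (CommutativeMonoid.commutativeSemigroup *-1-commutativeMonoid) using (x∙yz≈y∙xz)

module _ {a} {A : Set a} where

  ∈-─⁺ : ∀ {x y : A} {ys} (x∈ys : x ∈ ys) → y ∈ ys → y ≢ x → y ∈ (ys ─ x∈ys)
  ∈-─⁺ (here refl)  (here refl)  y≢x = contradiction refl y≢x
  ∈-─⁺ (here _)     (there y∈ys) _   = y∈ys
  ∈-─⁺ (there _)    (here y≡z)   _   = here y≡z
  ∈-─⁺ (there x∈ys) (there y∈ys) y≢x = there (∈-─⁺ x∈ys y∈ys y≢x)

  Unique-⊆⇒length-≤ : ∀ {xs ys : List A} → Unique xs → xs ⊆ ys → length xs ℕ.≤ length ys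
  Unique-⊆⇒length-≤ {[]}          _            _     = z≤n
  Unique-⊆⇒length-≤ {x ∷ xs} {ys} (x∉xs ∷ xs!) xs⊆ys = begin
    suc (length xs)          ≤⟨ s≤s (Unique-⊆⇒length-≤ xs! xs⊆ys─x) ⟩
    suc (length (ys ─ x∈ys)) ≡⟨ length-removeAt′ ys (index x∈ys) ⟨
    length ys                ∎
    where
    open ℕ.≤-Reasoning
    x∈ys : x ∈ ys
    x∈ys = xs⊆ys (here refl)
    xs⊆ys─x : xs ⊆ (ys ─ x∈ys)
    xs⊆ys─x y∈xs = ∈-─⁺ x∈ys (xs⊆ys (there y∈xs)) (≢-sym (All.lookup x∉xs y∈xs))

module Distinguishability (G : Graph) where

  distinguishable-∷ : ∀ {n a c} {x y : Vec Bool n} →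
                      Distinguishable G x y → Distinguishable G (a ∷ x) (c ∷ y)
  distinguishable-∷ (i , j , j≡1+i , e) = suc i , suc j , cong suc j≡1+i , e

  distinguishable-head : ∀ {n a b c d} {x y : Vec Bool n} →
                         G (a , b) (c , d) → Distinguishable G (a ∷ b ∷ x) (c ∷ d ∷ y)
  distinguishable-head e = zero , suc zero , refl , e

  distinguishable-∷⁻ : ∀ {n a b c d} {x y : Vec Bool n} →
                       Distinguishable G (a ∷ b ∷ x) (c ∷ d ∷ y) →
                       G (a , b) (c , d) ⊎ Distinguishable G (b ∷ x) (d ∷ y)
  distinguishable-∷⁻ (zero  , suc zero    , refl  , e) = inj₁ e
  distinguishable-∷⁻ (zero  , zero        , ()    , _)
  distinguishable-∷⁻ (zero  , suc (suc _) , ()    , _)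
  distinguishable-∷⁻ (suc _ , zero        , ()    , _)
  distinguishable-∷⁻ (suc i , suc j       , j≡1+i , e) = inj₂ (i , j , ℕ.suc-injective j≡1+i , e)

  ¬distinguishable-[_] : ∀ {a c} → ¬ Distinguishable G (a ∷ []) (c ∷ [])
  ¬distinguishable-[_] (zero , zero , () , _)

open Distinguishability F

module _ (W₁ : List (Vec Bool 1)) (W₂ : List (Vec Bool 2)) where

  blockWords : (n : ℕ) → List (Vec Bool n)
  blockWords 0 = [] ∷ []
  blockWords 1 = W₁
  blockWords 2 = W₂
  blockWords (suc (suc (suc n))) =
    map (false ∷_) (blockWords (suc (suc n))) ++
    map (λ v → true ∷ false ∷ v) (blockWords (suc n)) ++
    map (λ v → true ∷ true ∷ false ∷ v) (blockWords n)

  length-blockWords : ∀ n → length (blockWords (3 ℕ.+ n)) ≡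
    length (blockWords (2 ℕ.+ n)) ℕ.+ length (blockWords (1 ℕ.+ n)) ℕ.+ length (blockWords n)
  length-blockWords n = begin
    length (map f₀ B₂ ++ map f₁₀ B₁ ++ map f₁₁₀ B₀)
      ≡⟨ length-++ (map f₀ B₂) ⟩
    length (map f₀ B₂) ℕ.+ length (map f₁₀ B₁ ++ map f₁₁₀ B₀)
      ≡⟨ cong (length (map f₀ B₂) ℕ.+_) (length-++ (map f₁₀ B₁)) ⟩
    length (map f₀ B₂) ℕ.+ (length (map f₁₀ B₁) ℕ.+ length (map f₁₁₀ B₀))
      ≡⟨ cong₂ ℕ._+_ (length-map f₀ B₂) (cong₂ ℕ._+_ (length-map f₁₀ B₁) (length-map f₁₁₀ B₀)) ⟩
    length B₂ ℕ.+ (length B₁ ℕ.+ length B₀)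
      ≡⟨ ℕ.+-assoc (length B₂) (length B₁) (length B₀) ⟨
    length B₂ ℕ.+ length B₁ ℕ.+ length B₀
      ∎
    where
    open ≡-Reasoning
    B₀ = blockWords n
    B₁ = blockWords (1 ℕ.+ n)
    B₂ = blockWords (2 ℕ.+ n)
    f₀ f₁₀ f₁₁₀ : ∀ {m} → Vec Bool m → Vec Bool _
    f₀ v = false ∷ v
    f₁₀ v = true ∷ false ∷ v
    f₁₁₀ v = true ∷ true ∷ false ∷ v

tripleOneFree : (n : ℕ) → List (Vec Bool n)
tripleOneFree = blockWords
  ((false ∷ []) ∷ (true ∷ []) ∷ [])
  ((false ∷ false ∷ []) ∷ (false ∷ true ∷ []) ∷ (true ∷ false ∷ []) ∷ (true ∷ true ∷ []) ∷ [])

tilings : (n : ℕ) → List (Vec Bool n)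
tilings = blockWords ((false ∷ []) ∷ []) ((false ∷ false ∷ []) ∷ (true ∷ false ∷ []) ∷ [])

false∷-∈ : ∀ {n} {v : Vec Bool n} → v ∈ tripleOneFree n → false ∷ v ∈ tripleOneFree (suc n)
false∷-∈ {0}           (here refl)         = here refl
false∷-∈ {1}           (here refl)         = here refl
false∷-∈ {1}           (there (here refl)) = there (here refl)
false∷-∈ {suc (suc n)} v∈                  = ∈-++⁺ˡ (∈-map⁺ (false ∷_) v∈)

true∷false∷-∈ : ∀ {n} {v : Vec Bool n} → v ∈ tripleOneFree n → true ∷ false ∷ v ∈ tripleOneFree (2 ℕ.+ n)
true∷false∷-∈ {0}     (here refl) = there (there (here refl))
true∷false∷-∈ {suc n} v∈          =
  ∈-++⁺ʳ (map (false ∷_) (tripleOneFree (2 ℕ.+ n)))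
    (∈-++⁺ˡ {ys = map (λ w → true ∷ true ∷ false ∷ w) (tripleOneFree n)} (∈-map⁺ (λ w → true ∷ false ∷ w) v∈))

true∷true∷false∷-∈ : ∀ {n} {v : Vec Bool n} → v ∈ tripleOneFree n →
                     true ∷ true ∷ false ∷ v ∈ tripleOneFree (3 ℕ.+ n)
true∷true∷false∷-∈ {n} v∈ =
  ∈-++⁺ʳ (map (false ∷_) (tripleOneFree (2 ℕ.+ n)))
    (∈-++⁺ʳ (map (λ w → true ∷ false ∷ w) (tripleOneFree (1 ℕ.+ n))) (∈-map⁺ (λ w → true ∷ true ∷ false ∷ w) v∈))

Agrees : ∀ {n} → Vec Bool n → Vec Bool n → Set
Agrees []          []          = ⊤
Agrees (_ ∷ [])    (_ ∷ [])    = ⊤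
Agrees (a ∷ b ∷ x) (c ∷ d ∷ s) = ((a , b) ≢ (true , true) → (c , d) ≡ (a , b)) × Agrees (b ∷ x) (d ∷ s)

Agrees-tail : ∀ {n a c} {x s : Vec Bool n} → Agrees (a ∷ x) (c ∷ s) → Agrees x s
Agrees-tail {x = []}    {[]}    _         = tt
Agrees-tail {x = _ ∷ _} {_ ∷ _} (_ , agr) = agr

agreeing-indistinguishable : ∀ {n} {x y s : Vec Bool n} → Agrees x s → Agrees y s → ¬ Distinguishable F x y
agreeing-indistinguishable {x = []} _ _ (() , _)
agreeing-indistinguishable {x = _ ∷ []} {_ ∷ []} {_ ∷ []} _ _ = ¬distinguishable-[_]
agreeing-indistinguishable {x = _ ∷ _ ∷ _} {_ ∷ _ ∷ _} {_ ∷ _ ∷ _} (agr-x , x-agr) (agr-y , y-agr) =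
  [ (λ { (xy-differ , x-vertex , y-vertex) → xy-differ (trans (sym (agr-x x-vertex)) (agr-y y-vertex)) })
  , agreeing-indistinguishable x-agr y-agr
  ] ∘ distinguishable-∷⁻

-- represent a x is the representative of x read after the letter a.  Every pair inside a run of
-- ones is 11, so the run may be changed as long as its first and last letters stay 1: a run 1ᵏ
-- becomes 1(01)^⌊(k-1)/2⌋, followed by one more 1 when k is even.
represent : ∀ {n} → Bool → Vec Bool n → Vec Bool n
represent _     []                 = []
represent false (b ∷ x)            = b ∷ represent b x
represent true  (false ∷ x)        = false ∷ represent false x
represent true  (true ∷ [])        = true ∷ []
represent true  (true ∷ false ∷ x) = true ∷ false ∷ represent false x
represent true  (true ∷ true ∷ x)  = false ∷ true ∷ represent true x

represent-agrees : ∀ {n} a (x : Vec Bool n) → Agrees (a ∷ x) (a ∷ represent a x)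
represent-agrees _     []                 = tt
represent-agrees false (b ∷ x)            = (λ _ → refl) , represent-agrees b x
represent-agrees true  (false ∷ x)        = (λ _ → refl) , represent-agrees false x
represent-agrees true  (true ∷ [])        = (λ _ → refl) , tt
represent-agrees true  (true ∷ false ∷ x) = (λ _ → refl) , (λ _ → refl) , represent-agrees false x
represent-agrees true  (true ∷ true ∷ x)  =
  (λ 11≢11 → contradiction refl 11≢11) , (λ 11≢11 → contradiction refl 11≢11) , represent-agrees true x

represent-∈ : ∀ {n} (x : Vec Bool n) → represent false x ∈ tripleOneFree n
represent-after-one-∈ : ∀ {n} (x : Vec Bool n) → true ∷ represent true x ∈ tripleOneFree (suc n)

represent-∈ []          = here refl
represent-∈ (false ∷ x) = false∷-∈ (represent-∈ x)
represent-∈ (true ∷ x)  = represent-after-one-∈ x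

represent-after-one-∈ []                 = there (here refl)
represent-after-one-∈ (false ∷ x)        = true∷false∷-∈ (represent-∈ x)
represent-after-one-∈ (true ∷ [])        = there (there (there (here refl)))
represent-after-one-∈ (true ∷ false ∷ x) = true∷true∷false∷-∈ (represent-∈ x)
represent-after-one-∈ (true ∷ true ∷ x)  = true∷false∷-∈ (represent-after-one-∈ x)

code-length-≤ : ∀ {n} {C : List (Vec Bool n)} → IsCode F n C → length C ℕ.≤ length (tripleOneFree n)
code-length-≤ {n} {C} code = begin
  length C                          ≡⟨ length-map (represent false) C ⟨
  length (map (represent false) C)  ≤⟨ Unique-⊆⇒length-≤ representatives-unique representatives-⊆ ⟩
  length (tripleOneFree n)          ∎
  where
  open ℕ.≤-Reasoning
  agrees : ∀ (x : Vec Bool n) → Agrees x (represent false x)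
  agrees x = Agrees-tail (represent-agrees false x)
  represent-injective : ∀ {x y} → Distinguishable F x y → represent false x ≢ represent false y
  represent-injective {x} {y} dist same =
    agreeing-indistinguishable (agrees x) (subst (Agrees y) (sym same) (agrees y)) dist
  representatives-unique : Unique (map (represent false) C)
  representatives-unique = AllPairs.map⁺ (AllPairs.map represent-injective code)
  representatives-⊆ : map (represent false) C ⊆ tripleOneFree n
  representatives-⊆ s∈ with ∈-map⁻ (represent false) s∈
  ... | x , _ , refl = represent-∈ x

DistinguishableAfter0 : ∀ {n} → Vec Bool n → Vec Bool n → Set
DistinguishableAfter0 u v = Distinguishable F (false ∷ u) (false ∷ v)

universal-map : ∀ {A B : Set} {P : B → Set} (f : A → B) → (∀ a → P (f a)) → ∀ xs → All P (map f xs)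
universal-map f Pf xs = All.map⁺ (All.universal Pf xs)

tilings-distinguishable : ∀ n → AllPairs DistinguishableAfter0 (tilings n)
tilings-distinguishable 0 = [] ∷ []
tilings-distinguishable 1 = [] ∷ []
tilings-distinguishable 2 = (distinguishable-head ((λ ()) , (λ ()) , (λ ())) ∷ []) ∷ [] ∷ []
tilings-distinguishable (suc (suc (suc n))) =
  AllPairs.++⁺ (AllPairs.map⁺ (AllPairs.map distinguishable-∷ (tilings-distinguishable (suc (suc n)))))
    (AllPairs.++⁺ (AllPairs.map⁺ (AllPairs.map (distinguishable-∷ ∘ distinguishable-∷) (tilings-distinguishable (suc n))))
                  (AllPairs.map⁺ (AllPairs.map (distinguishable-∷ ∘ distinguishable-∷ ∘ distinguishable-∷)
                                               (tilings-distinguishable n)))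
                  across-10-110)
    across-0
  where
  0-vs-1 : ∀ {m} (u v : Vec Bool m) → DistinguishableAfter0 (false ∷ u) (true ∷ v)
  0-vs-1 u v = distinguishable-head ((λ ()) , (λ ()) , (λ ()))
  10-vs-110 : ∀ {m} c (u v : Vec Bool m) → DistinguishableAfter0 (true ∷ false ∷ c ∷ u) (true ∷ true ∷ false ∷ v)
  10-vs-110 c u v = distinguishable-∷ (distinguishable-∷ (distinguishable-head ((λ ()) , (λ ()) , (λ ()))))
  across-10-110 : All (λ u → All (DistinguishableAfter0 u) (map (λ v → true ∷ true ∷ false ∷ v) (tilings n)))
                      (map (λ v → true ∷ false ∷ v) (tilings (1 ℕ.+ n)))
  across-10-110 = universal-map _ (λ { (c ∷ u) → universal-map _ (10-vs-110 c u) (tilings n) }) (tilings (1 ℕ.+ n))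
  across-0 : All (λ u → All (DistinguishableAfter0 u) (map (λ v → true ∷ false ∷ v) (tilings (1 ℕ.+ n)) ++
                                                        map (λ v → true ∷ true ∷ false ∷ v) (tilings n)))
                 (map (false ∷_) (tilings (2 ℕ.+ n)))
  across-0 = universal-map (false ∷_)
    (λ u → All.++⁺ (universal-map _ (λ v → 0-vs-1 u (false ∷ v)) (tilings (1 ℕ.+ n)))
                   (universal-map _ (λ v → 0-vs-1 u (true ∷ false ∷ v)) (tilings n)))
    (tilings (2 ℕ.+ n))

tilings-code : ∀ n → IsCode F (suc n) (map (false ∷_) (tilings n))
tilings-code n = AllPairs.map⁺ (tilings-distinguishable n)

ℚ-ring : ACR.AlmostCommutativeRing 0ℓ 0ℓ
ℚ-ring = ACR.fromCommutativeRing +-*-commutativeRing (λ q → dec⇒maybe (0ℚ ≟ q))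

0≤1 : 0ℚ ≤ 1ℚ
0≤1 = *≤* (ℤ.+≤+ z≤n)

0<1 : 0ℚ < 1ℚ
0<1 = *<* (ℤ.+<+ (s≤s z≤n))

p≤p+q : ∀ {p q} → 0ℚ ≤ q → p ≤ p + q
p≤p+q {p} {q} 0≤q = begin
  p       ≡⟨ +-identityʳ p ⟨
  p + 0ℚ  ≤⟨ +-monoʳ-≤ p 0≤q ⟩
  p + q   ∎
  where open ≤-Reasoning

p≤q⇒0≤q-p : ∀ {p q} → p ≤ q → 0ℚ ≤ q - p
p≤q⇒0≤q-p {p} {q} p≤q = subst (_≤ q - p) (+-inverseʳ p) (+-monoˡ-≤ (- p) p≤q)

p<q⇒0<q-p : ∀ {p q} → p < q → 0ℚ < q - p
p<q⇒0<q-p {p} {q} p<q = subst (_< q - p) (+-inverseʳ p) (+-monoˡ-< (- p) p<q)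

0≤p*q : ∀ {p q} → 0ℚ ≤ p → 0ℚ ≤ q → 0ℚ ≤ p * q
0≤p*q {p} {q} 0≤p 0≤q = nonNegative⁻¹ (p * q) {{nonNeg*nonNeg⇒nonNeg p {{nonNegative 0≤p}} q {{nonNegative 0≤q}}}}

0<p*q : ∀ {p q} → 0ℚ < p → 0ℚ < q → 0ℚ < p * q
0<p*q {p} {q} 0<p 0<q = positive⁻¹ (p * q) {{pos*pos⇒pos p {{positive 0<p}} q {{positive 0<q}}}}

0<p⊓q : ∀ {p q} → 0ℚ < p → 0ℚ < q → 0ℚ < p ⊓ q
0<p⊓q {p} {q} 0<p 0<q = [ (λ p⊓q≡p → subst (0ℚ <_) (sym p⊓q≡p) 0<p)
                        , (λ p⊓q≡q → subst (0ℚ <_) (sym p⊓q≡q) 0<q) ]′ (⊓-sel p q)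

private
  toℚ≡mkℚ : ∀ k → toℚ k ≡ mkℚ (+ k) 0 (Coprimality.sym (Coprimality.1-coprimeTo k))
  toℚ≡mkℚ k = normalize-coprime (Coprimality.sym (Coprimality.1-coprimeTo k))

-- On denominators 1, ℚ's _+_ unfolds to the middle expression.
toℚ-+ : ∀ m n → toℚ (m ℕ.+ n) ≡ toℚ m + toℚ n
toℚ-+ m n = begin
  toℚ (m ℕ.+ n)                      ≡⟨ cong₂ (λ i j → (i ℤ.+ j) / 1) (ℤ.*-identityʳ (+ m)) (ℤ.*-identityʳ (+ n)) ⟨
  (+ m ℤ.* + 1 ℤ.+ + n ℤ.* + 1) / 1  ≡⟨ cong₂ _+_ (toℚ≡mkℚ m) (toℚ≡mkℚ n) ⟨
  toℚ m + toℚ n                      ∎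
  where open ≡-Reasoning

toℚ-suc : ∀ k → toℚ (suc k) ≡ 1ℚ + toℚ k
toℚ-suc = toℚ-+ 1

toℚ-mono-≤ : ∀ {m n} → m ℕ.≤ n → toℚ m ≤ toℚ n
toℚ-mono-≤ {m} {n} m≤n = subst₂ _≤_ (sym (toℚ≡mkℚ m)) (sym (toℚ≡mkℚ n))
  (*≤* (subst₂ ℤ._≤_ (sym (ℤ.*-identityʳ (+ m))) (sym (ℤ.*-identityʳ (+ n))) (ℤ.+≤+ m≤n)))

toℚ-nonNeg : ∀ k → 0ℚ ≤ toℚ k
toℚ-nonNeg k = toℚ-mono-≤ (z≤n {k})

toℚ-pos : ∀ k → 0ℚ < toℚ (suc k)
toℚ-pos k = <-≤-trans 0<1 (toℚ-mono-≤ (s≤s (z≤n {k})))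

toℚ-unbounded : ∀ q → ∃[ k ] q ≤ toℚ k
toℚ-unbounded q@(mkℚ (+ m) d _) = m , subst (q ≤_) (sym (toℚ≡mkℚ m))
  (*≤* (subst₂ ℤ._≤_ (sym (ℤ.*-identityʳ (+ m))) (ℤ.pos-* m (suc d)) (ℤ.+≤+ (ℕ.m≤m*n m (suc d)))))
toℚ-unbounded (mkℚ -[1+ _ ] _ _) = 0 , *≤* ℤ.-≤+

pow-nonNeg : ∀ {s} → 0ℚ ≤ s → ∀ k → 0ℚ ≤ pow s k
pow-nonNeg 0≤s zero    = 0≤1
pow-nonNeg 0≤s (suc k) = 0≤p*q 0≤s (pow-nonNeg 0≤s k)

pow-pos : ∀ {s} → 0ℚ < s → ∀ k → 0ℚ < pow s k
pow-pos 0<s zero    = 0<1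
pow-pos 0<s (suc k) = 0<p*q 0<s (pow-pos 0<s k)

pow*[1+k[1-s]]≤1 : ∀ {s} → 0ℚ ≤ s → s ≤ 1ℚ → ∀ k → pow s k * (1ℚ + toℚ k * (1ℚ - s)) ≤ 1ℚ
pow*[1+k[1-s]]≤1 {s} _ _ zero = ≤-reflexive (base s)
  where
  base : ∀ s → 1ℚ * (1ℚ + 0ℚ * (1ℚ - s)) ≡ 1ℚ
  base = solve-∀ ℚ-ring
pow*[1+k[1-s]]≤1 {s} 0≤s s≤1 (suc k) = begin
  s * pow s k * (1ℚ + toℚ (suc k) * (1ℚ - s))  ≡⟨ cong (λ K → s * pow s k * (1ℚ + K * (1ℚ - s))) (toℚ-suc k) ⟩
  s * pow s k * (1ℚ + (1ℚ + K) * (1ℚ - s))     ≡⟨ regroup s (pow s k) K ⟩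
  pow s k * (s * (1ℚ + (1ℚ + K) * (1ℚ - s)))   ≤⟨ *-monoˡ-≤-nonNeg (pow s k) {{nonNegative (pow-nonNeg 0≤s k)}} step ⟩
  pow s k * (1ℚ + K * (1ℚ - s))                ≤⟨ pow*[1+k[1-s]]≤1 0≤s s≤1 k ⟩
  1ℚ                                           ∎
  where
  open ≤-Reasoning
  K = toℚ k
  0≤1-s : 0ℚ ≤ 1ℚ - s
  0≤1-s = p≤q⇒0≤q-p s≤1
  0≤1+K : 0ℚ ≤ 1ℚ + K
  0≤1+K = subst (0ℚ ≤_) (toℚ-suc k) (toℚ-nonNeg (suc k))
  regroup : ∀ s P K → s * P * (1ℚ + (1ℚ + K) * (1ℚ - s)) ≡ P * (s * (1ℚ + (1ℚ + K) * (1ℚ - s)))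
  regroup = solve-∀ ℚ-ring
  expand : ∀ s K → s * (1ℚ + (1ℚ + K) * (1ℚ - s)) + (1ℚ + K) * (1ℚ - s) * (1ℚ - s) ≡ 1ℚ + K * (1ℚ - s)
  expand = solve-∀ ℚ-ring
  step : s * (1ℚ + (1ℚ + K) * (1ℚ - s)) ≤ 1ℚ + K * (1ℚ - s)
  step = begin
    s * (1ℚ + (1ℚ + K) * (1ℚ - s))                                   ≤⟨ p≤p+q (0≤p*q (0≤p*q 0≤1+K 0≤1-s) 0≤1-s) ⟩
    s * (1ℚ + (1ℚ + K) * (1ℚ - s)) + (1ℚ + K) * (1ℚ - s) * (1ℚ - s)  ≡⟨ expand s K ⟩
    1ℚ + K * (1ℚ - s)                                                ∎

bernoulli : ∀ {s} → 1ℚ ≤ s → ∀ k → 1ℚ + toℚ k * (s - 1ℚ) ≤ pow s k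
bernoulli {s} _ zero = ≤-reflexive (base s)
  where
  base : ∀ s → 1ℚ + 0ℚ * (s - 1ℚ) ≡ 1ℚ
  base = solve-∀ ℚ-ring
bernoulli {s} 1≤s (suc k) = begin
  1ℚ + toℚ (suc k) * (s - 1ℚ)                         ≡⟨ cong (λ K → 1ℚ + K * (s - 1ℚ)) (toℚ-suc k) ⟩
  1ℚ + (1ℚ + K) * (s - 1ℚ)                            ≤⟨ p≤p+q (0≤p*q (0≤p*q (toℚ-nonNeg k) 0≤s-1) 0≤s-1) ⟩
  1ℚ + (1ℚ + K) * (s - 1ℚ) + K * (s - 1ℚ) * (s - 1ℚ)  ≡⟨ expand s K ⟩
  s * (1ℚ + K * (s - 1ℚ))                             ≤⟨ *-monoˡ-≤-nonNeg s {{nonNegative (≤-trans 0≤1 1≤s)}} (bernoulli 1≤s k) ⟩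
  s * pow s k                                         ∎
  where
  open ≤-Reasoning
  K = toℚ k
  0≤s-1 : 0ℚ ≤ s - 1ℚ
  0≤s-1 = p≤q⇒0≤q-p 1≤s
  expand : ∀ s K → 1ℚ + (1ℚ + K) * (s - 1ℚ) + K * (s - 1ℚ) * (s - 1ℚ) ≡ s * (1ℚ + K * (s - 1ℚ))
  expand = solve-∀ ℚ-ring

pow-decays : ∀ {s} → 0ℚ ≤ s → s < 1ℚ → ∀ M → ∃[ k ] M * pow s k ≤ 1ℚ
pow-decays {s} 0≤s s<1 M = let k , M/d≤k = toℚ-unbounded (M * 1/ d) in k , M*sᵏ≤1 {k} M/d≤k
  where
  open ≤-Reasoning
  d : ℚ
  d = 1ℚ - s
  instance
    d≢0 : NonZero d
    d≢0 = pos⇒nonZero d {{positive (p<q⇒0<q-p s<1)}}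
  M*sᵏ≤1 : ∀ {k} → M * 1/ d ≤ toℚ k → M * pow s k ≤ 1ℚ
  M*sᵏ≤1 {k} M/d≤k = begin
    M * pow s k                 ≤⟨ *-monoʳ-≤-nonNeg (pow s k) {{nonNegative (pow-nonNeg 0≤s k)}} M≤1+kd ⟩
    (1ℚ + toℚ k * d) * pow s k  ≡⟨ *-comm _ (pow s k) ⟩
    pow s k * (1ℚ + toℚ k * d)  ≤⟨ pow*[1+k[1-s]]≤1 0≤s (<⇒≤ s<1) k ⟩
    1ℚ                          ∎
    where
    M≤1+kd : M ≤ 1ℚ + toℚ k * d
    M≤1+kd = begin
      M               ≡⟨ *-identityʳ M ⟨
      M * 1ℚ          ≡⟨ cong (M *_) (*-inverseˡ d) ⟨
      M * (1/ d * d)  ≡⟨ *-assoc M (1/ d) d ⟨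
      M * 1/ d * d    ≤⟨ *-monoʳ-≤-nonNeg d {{nonNegative (p≤q⇒0≤q-p (<⇒≤ s<1))}} M/d≤k ⟩
      toℚ k * d       ≤⟨ p≤p+q 0≤1 ⟩
      toℚ k * d + 1ℚ  ≡⟨ +-comm (toℚ k * d) 1ℚ ⟩
      1ℚ + toℚ k * d  ∎

pow-grows : ∀ {s} → 1ℚ < s → ∀ m → 0ℚ < m → ∃[ k ] 1ℚ ≤ m * pow s k
pow-grows {s} 1<s m 0<m = let k , 1/me≤k = toℚ-unbounded (1/ (m * e)) in k , 1≤m*sᵏ {k} 1/me≤k
  where
  open ≤-Reasoning
  e : ℚ
  e = s - 1ℚ
  0<me : 0ℚ < m * e
  0<me = 0<p*q 0<m (p<q⇒0<q-p 1<s)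
  instance
    me≢0 : NonZero (m * e)
    me≢0 = pos⇒nonZero (m * e) {{positive 0<me}}
  regroup : ∀ K m e → K * (m * e) + m ≡ m * (1ℚ + K * e)
  regroup = solve-∀ ℚ-ring
  1≤m*sᵏ : ∀ {k} → 1/ (m * e) ≤ toℚ k → 1ℚ ≤ m * pow s k
  1≤m*sᵏ {k} 1/me≤k = begin
    1ℚ                    ≡⟨ *-inverseˡ (m * e) ⟨
    1/ (m * e) * (m * e)  ≤⟨ *-monoʳ-≤-nonNeg (m * e) {{nonNegative (<⇒≤ 0<me)}} 1/me≤k ⟩
    toℚ k * (m * e)       ≤⟨ p≤p+q (<⇒≤ 0<m) ⟩
    toℚ k * (m * e) + m   ≡⟨ regroup (toℚ k) m e ⟩
    m * (1ℚ + toℚ k * e)  ≤⟨ *-monoˡ-≤-nonNeg m {{nonNegative (<⇒≤ 0<m)}} (bernoulli (<⇒≤ 1<s) k) ⟩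
    m * pow s k           ∎

module ThirdOrderRecurrence
  (p q r : ℚ) (0≤p : 0ℚ ≤ p) (0≤q : 0ℚ ≤ q) (0≤r : 0ℚ ≤ r)
  (b : ℕ → ℚ) (b-rec : ∀ n → b (3 ℕ.+ n) ≡ p * b (2 ℕ.+ n) + q * b (1 ℕ.+ n) + r * b n)
  where

  s : ℚ
  s = p + q + r

  0≤s : 0ℚ ≤ s
  0≤s = +-mono-≤ (+-mono-≤ 0≤p 0≤q) 0≤r

  private
    instance
      p-nonNeg = nonNegative 0≤p
      q-nonNeg = nonNegative 0≤q
      r-nonNeg = nonNegative 0≤r

    s*D≡ : ∀ D → s * D ≡ p * D + q * D + r * D
    s*D≡ D = trans (*-distribʳ-+ D (p + q) r) (cong (_+ r * D) (*-distribʳ-+ D p q))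

    combination-≤ : ∀ {A B C D} → A ≤ D → B ≤ D → C ≤ D → p * A + q * B + r * C ≤ s * D
    combination-≤ {D = D} A≤D B≤D C≤D = begin
      _                      ≤⟨ +-mono-≤ (+-mono-≤ (*-monoˡ-≤-nonNeg p A≤D) (*-monoˡ-≤-nonNeg q B≤D))
                                         (*-monoˡ-≤-nonNeg r C≤D) ⟩
      p * D + q * D + r * D  ≡⟨ s*D≡ D ⟨
      s * D                  ∎
      where open ≤-Reasoning

    combination-≥ : ∀ {A B C D} → D ≤ A → D ≤ B → D ≤ C → s * D ≤ p * A + q * B + r * C
    combination-≥ {D = D} D≤A D≤B D≤C = begin
      s * D                  ≡⟨ s*D≡ D ⟩
      p * D + q * D + r * D  ≤⟨ +-mono-≤ (+-mono-≤ (*-monoˡ-≤-nonNeg p D≤A) (*-monoˡ-≤-nonNeg q D≤B))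
                                         (*-monoˡ-≤-nonNeg r D≤C) ⟩
      _                      ∎
      where open ≤-Reasoning

  module _ {M} (s≤1 : s ≤ 1ℚ) (0≤M : 0ℚ ≤ M) (b₀≤M : b 0 ≤ M) (b₁≤M : b 1 ≤ M) (b₂≤M : b 2 ≤ M) where
    open ≤-Reasoning

    b≤M : ∀ n → b n ≤ M
    b≤M 0 = b₀≤M
    b≤M 1 = b₁≤M
    b≤M 2 = b₂≤M
    b≤M (suc (suc (suc n))) = begin
      b (3 ℕ.+ n)  ≡⟨ b-rec n ⟩
      _            ≤⟨ combination-≤ (b≤M (suc (suc n))) (b≤M (suc n)) (b≤M n) ⟩
      s * M        ≤⟨ *-monoʳ-≤-nonNeg M {{nonNegative 0≤M}} s≤1 ⟩
      1ℚ * M       ≡⟨ *-identityˡ M ⟩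
      M            ∎

    b≤M*sᵏ : ∀ k {n} → k ℕ.* 3 ℕ.≤ n → b n ≤ M * pow s k
    b≤M*sᵏ zero {n} _ = begin
      b n     ≤⟨ b≤M n ⟩
      M       ≡⟨ *-identityʳ M ⟨
      M * 1ℚ  ∎
    b≤M*sᵏ (suc k) {suc (suc (suc n))} (s≤s (s≤s (s≤s k*3≤n))) = begin
      b (3 ℕ.+ n)        ≡⟨ b-rec n ⟩
      _                  ≤⟨ combination-≤ (b≤M*sᵏ k (ℕ.m≤n⇒m≤1+n (ℕ.m≤n⇒m≤1+n k*3≤n)))
                                          (b≤M*sᵏ k (ℕ.m≤n⇒m≤1+n k*3≤n))
                                          (b≤M*sᵏ k k*3≤n) ⟩
      s * (M * pow s k)  ≡⟨ x∙yz≈y∙xz s M (pow s k) ⟩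
      M * (s * pow s k)  ∎

  module _ {m} (1≤s : 1ℚ ≤ s) (0≤m : 0ℚ ≤ m) (m≤b₀ : m ≤ b 0) (m≤b₁ : m ≤ b 1) (m≤b₂ : m ≤ b 2) where
    open ≤-Reasoning

    m≤b : ∀ n → m ≤ b n
    m≤b 0 = m≤b₀
    m≤b 1 = m≤b₁
    m≤b 2 = m≤b₂
    m≤b (suc (suc (suc n))) = begin
      m            ≡⟨ *-identityˡ m ⟨
      1ℚ * m       ≤⟨ *-monoʳ-≤-nonNeg m {{nonNegative 0≤m}} 1≤s ⟩
      s * m        ≤⟨ combination-≥ (m≤b (suc (suc n))) (m≤b (suc n)) (m≤b n) ⟩
      _            ≡⟨ b-rec n ⟨
      b (3 ℕ.+ n)  ∎

    m*sᵏ≤b : ∀ k {n} → k ℕ.* 3 ℕ.≤ n → m * pow s k ≤ b n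
    m*sᵏ≤b zero {n} _ = begin
      m * 1ℚ  ≡⟨ *-identityʳ m ⟩
      m       ≤⟨ m≤b n ⟩
      b n     ∎
    m*sᵏ≤b (suc k) {suc (suc (suc n))} (s≤s (s≤s (s≤s k*3≤n))) = begin
      m * (s * pow s k)  ≡⟨ x∙yz≈y∙xz m s (pow s k) ⟩
      s * (m * pow s k)  ≤⟨ combination-≥ (m*sᵏ≤b k (ℕ.m≤n⇒m≤1+n (ℕ.m≤n⇒m≤1+n k*3≤n)))
                                          (m*sᵏ≤b k (ℕ.m≤n⇒m≤1+n k*3≤n))
                                          (m*sᵏ≤b k k*3≤n) ⟩
      _                  ≡⟨ b-rec n ⟨
      b (3 ℕ.+ n)        ∎

module _ (t : ℕ → ℕ) (t-rec : ∀ n → t (3 ℕ.+ n) ≡ t (2 ℕ.+ n) ℕ.+ t (1 ℕ.+ n) ℕ.+ t n)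
         (x : ℚ) (w : ℕ → ℚ) (w-suc : ∀ n → w (suc n) ≡ x * w n) where

  weighted-recurrence : ∀ n → toℚ (t (3 ℕ.+ n)) * w (3 ℕ.+ n) ≡
    x * (toℚ (t (2 ℕ.+ n)) * w (2 ℕ.+ n)) + x * x * (toℚ (t (1 ℕ.+ n)) * w (1 ℕ.+ n)) + x * x * x * (toℚ (t n) * w n)
  weighted-recurrence n = begin
    toℚ (t (3 ℕ.+ n)) * w (3 ℕ.+ n)
      ≡⟨ cong₂ _*_ count w₃ ⟩
    (T₂ + T₁ + T₀) * (x * (x * (x * w n)))
      ≡⟨ distribute x T₀ T₁ T₂ (w n) ⟩
    x * (T₂ * (x * (x * w n))) + x * x * (T₁ * (x * w n)) + x * x * x * (T₀ * w n)
      ≡⟨ cong₂ (λ u v → x * (T₂ * u) + x * x * (T₁ * v) + x * x * x * (T₀ * w n)) w₂ w₁ ⟨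
    x * (T₂ * w (2 ℕ.+ n)) + x * x * (T₁ * w (1 ℕ.+ n)) + x * x * x * (T₀ * w n) ∎
    where
    open ≡-Reasoning
    T₀ = toℚ (t n)
    T₁ = toℚ (t (1 ℕ.+ n))
    T₂ = toℚ (t (2 ℕ.+ n))
    count : toℚ (t (3 ℕ.+ n)) ≡ T₂ + T₁ + T₀
    count = begin
      toℚ (t (3 ℕ.+ n))                                  ≡⟨ cong toℚ (t-rec n) ⟩
      toℚ (t (2 ℕ.+ n) ℕ.+ t (1 ℕ.+ n) ℕ.+ t n)          ≡⟨ toℚ-+ (t (2 ℕ.+ n) ℕ.+ t (1 ℕ.+ n)) (t n) ⟩
      toℚ (t (2 ℕ.+ n) ℕ.+ t (1 ℕ.+ n)) + T₀             ≡⟨ cong (_+ T₀) (toℚ-+ (t (2 ℕ.+ n)) (t (1 ℕ.+ n))) ⟩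
      T₂ + T₁ + T₀                                       ∎
    w₁ : w (1 ℕ.+ n) ≡ x * w n
    w₁ = w-suc n
    w₂ : w (2 ℕ.+ n) ≡ x * (x * w n)
    w₂ = trans (w-suc (1 ℕ.+ n)) (cong (x *_) w₁)
    w₃ : w (3 ℕ.+ n) ≡ x * (x * (x * w n))
    w₃ = trans (w-suc (2 ℕ.+ n)) (cong (x *_) w₂)
    distribute : ∀ x T₀ T₁ T₂ W → (T₂ + T₁ + T₀) * (x * (x * (x * W))) ≡
                 x * (T₂ * (x * (x * W))) + x * x * (T₁ * (x * W)) + x * x * x * (T₀ * W)
    distribute = solve-∀ ℚ-ring

capacity-upper-bound : (x : ℚ) → 0ℚ < x → x + x * x + x * x * x < 1ℚ →
  ∃[ N ] ((n : ℕ) → n ≥ N → (C : List (Vec Bool n)) → IsCode F n C → toℚ (length C) * pow x n ≤ 1ℚ)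
capacity-upper-bound x 0<x s<1 =
  let k , M*sᵏ≤1 = pow-decays 0≤s s<1 M in
  k ℕ.* 3 , λ n k*3≤n C code → begin
    toℚ (length C) * pow x n  ≤⟨ *-monoʳ-≤-nonNeg (pow x n) {{nonNegative (pow-nonNeg 0≤x n)}}
                                   (toℚ-mono-≤ (code-length-≤ code)) ⟩
    b n                       ≤⟨ b≤M*sᵏ (<⇒≤ s<1) 0≤M b₀≤M b₁≤M b₂≤M k k*3≤n ⟩
    M * pow s k               ≤⟨ M*sᵏ≤1 ⟩
    1ℚ                        ∎
  where
  open ≤-Reasoning
  0≤x : 0ℚ ≤ x
  0≤x = <⇒≤ 0<x
  b : ℕ → ℚ
  b n = toℚ (length (tripleOneFree n)) * pow x n
  open ThirdOrderRecurrence x (x * x) (x * x * x) 0≤x (0≤p*q 0≤x 0≤x) (0≤p*q (0≤p*q 0≤x 0≤x) 0≤x)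
    b (weighted-recurrence (λ n → length (tripleOneFree n)) (length-blockWords _ _) x (pow x) (λ _ → refl))
  M : ℚ
  M = b 0 ⊔ (b 1 ⊔ b 2)
  b₀≤M : b 0 ≤ M
  b₀≤M = p≤p⊔q (b 0) (b 1 ⊔ b 2)
  0≤M : 0ℚ ≤ M
  0≤M = ≤-trans {0ℚ} {b 0} 0≤1 b₀≤M
  b₁≤M : b 1 ≤ M
  b₁≤M = ≤-trans (p≤p⊔q (b 1) (b 2)) (p≤q⊔p (b 0) (b 1 ⊔ b 2))
  b₂≤M : b 2 ≤ M
  b₂≤M = ≤-trans (p≤q⊔p (b 1) (b 2)) (p≤q⊔p (b 0) (b 1 ⊔ b 2))

capacity-lower-bound : (x : ℚ) → 0ℚ < x → 1ℚ < x + x * x + x * x * x →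
  (N : ℕ) → ∃[ n ] ((n ≥ N) × Σ (List (Vec Bool n)) (λ C → IsCode F n C × 1ℚ ≤ toℚ (length C) * pow x n))
capacity-lower-bound x 0<x 1<s N =
  let k , 1≤m*sᵏ = pow-grows 1<s m 0<m
      n = N ℕ.+ k ℕ.* 3
  in suc n , ℕ.m≤n⇒m≤1+n (ℕ.m≤m+n N (k ℕ.* 3)) , code n , tilings-code n , (begin
    1ℚ                                  ≤⟨ 1≤m*sᵏ ⟩
    m * pow s k                         ≤⟨ m*sᵏ≤b (<⇒≤ 1<s) (<⇒≤ 0<m) m≤b₀ m≤b₁ m≤b₂ k (ℕ.m≤n+m (k ℕ.* 3) N) ⟩
    b n                                 ≡⟨ cong (λ l → toℚ l * pow x (suc n)) (length-map (false ∷_) (tilings n)) ⟨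
    toℚ (length (code n)) * pow x (suc n) ∎)
  where
  open ≤-Reasoning
  0≤x : 0ℚ ≤ x
  0≤x = <⇒≤ 0<x
  code : ∀ n → List (Vec Bool (suc n))
  code n = map (false ∷_) (tilings n)
  b : ℕ → ℚ
  b n = toℚ (length (tilings n)) * pow x (suc n)
  open ThirdOrderRecurrence x (x * x) (x * x * x) 0≤x (0≤p*q 0≤x 0≤x) (0≤p*q (0≤p*q 0≤x 0≤x) 0≤x)
    b (weighted-recurrence (λ n → length (tilings n)) (length-blockWords _ _) x (pow x ∘ suc) (λ _ → refl))
  0<b : ∀ n {l} → length (tilings n) ≡ suc l → 0ℚ < b n
  0<b n {l} |tilings|≡1+l = subst (λ t → 0ℚ < toℚ t * pow x (suc n)) (sym |tilings|≡1+l)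
    (0<p*q (toℚ-pos l) (pow-pos 0<x (suc n)))
  m : ℚ
  m = b 0 ⊓ (b 1 ⊓ b 2)
  0<m : 0ℚ < m
  0<m = 0<p⊓q (0<b 0 refl) (0<p⊓q (0<b 1 refl) (0<b 2 refl))
  m≤b₀ : m ≤ b 0
  m≤b₀ = p⊓q≤p (b 0) (b 1 ⊓ b 2)
  m≤b₁ : m ≤ b 1
  m≤b₁ = ≤-trans (p⊓q≤q (b 0) (b 1 ⊓ b 2)) (p⊓q≤p (b 1) (b 2))
  m≤b₂ : m ≤ b 2
  m≤b₂ = ≤-trans (p⊓q≤q (b 0) (b 1 ⊓ b 2)) (p⊓q≤q (b 1) (b 2))

theorem1 : ((x : ℚ) → 0ℚ < x → x + x * x + x * x * x < 1ℚ →
    ∃[ N ] ((n : ℕ) → n ≥ N → (C : List (Vec Bool n)) → IsCode F n C →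
    toℚ (length C) * pow x n ≤ 1ℚ))
    ×
    ((x : ℚ) → 0ℚ < x → 1ℚ < x + x * x + x * x * x →
    (N : ℕ) → ∃[ n ] ((n ≥ N) × Σ (List (Vec Bool n)) (λ C → IsCode F n C ×
    1ℚ ≤ toℚ (length C) * pow x n)))
theorem1 = capacity-upper-bound , capacity-lower-bound
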